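{- Consider two-probe data structures for the GNS problem with cells of $w$ bits, with success probability measured over random inputs (dataset, bit-string and query drawn from fixed distributions). If there exists a deterministic data structure which makes two cell probes adaptively and succeeds with probability at least $\frac12+\eta$, then there exists a deterministic data structure which makes the two cell probes non-adaptively and succeeds with probability at least $\frac12+\frac{\eta}{2^w}$.
   Context: GNS: there is a graph on a vertex set $V$; the input is a dataset $P=\{p_1,\dots,p_n\}\subseteq V$ and bits $x\in\{0,1\}^n$, preprocessed into a table $D:[m]\to\{0,1\}^w$; on a query $q$ whose unique neighbor in $P$ is $p_i$, the goal is to output $x_i$ after reading two cells of $D$. Adaptive: the index of the second probed cell may depend on the contents of the first; non-adaptive: both indices (and the output function of the two cell contents) depend only on $q$. -}

module Defs where

open import Data.Nat as ℕ using (ℕ; _^_)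
open import Data.Nat.Properties using (m^n≢0)
open import Data.Integer using (+_)
open import Data.Rational using (ℚ; 0ℚ; 1ℚ; _/_; _+_; _*_; _≤_)
open import Data.Fin using (Fin; zero; suc)
open import Data.Vec using (Vec)
open import Data.Bool using (Bool; true; false; _∧_; _∨_; not; if_then_else_)
open import Data.Bool.Properties using () renaming (_≟_ to _≟B_)
open import Data.List using (List; []; _∷_)
open import Data.List.Relation.Unary.All using (All)
open import Data.Product using (_×_; _,_; proj₁; proj₂; Σ)
open import Relation.Binary.PropositionalEquality using (_≡_)
open import Relation.Nullary.Decidable using (⌊_⌋)
open import Function.Definitions using (Injective)

Graph : ℕ → Set
Graph N = Fin N → Fin N → Bool

Cell : ℕ → Set
Cell w = Vec Bool w

Dataset : ℕ → ℕ → Set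
Dataset N n = Fin n → Fin N

Input : ℕ → ℕ → Set
Input N n = Dataset N n × (Fin n → Bool) × Fin N

UniqueNbr : ∀ {N n} → Graph N → Dataset N n → Fin N → Fin n → Set
UniqueNbr G P q i = (G q (P i) ≡ true) × (∀ j → G q (P j) ≡ true → j ≡ i)

Promise : ∀ {N n} → Graph N → Input N n → Set
Promise {n = n} G (P , x , q) = Injective _≡_ _≡_ P × Σ (Fin n) (UniqueNbr G P q)

allFin : ∀ {n} → (Fin n → Bool) → Bool
allFin {ℕ.zero} f = true
allFin {ℕ.suc n} f = f zero ∧ allFin (λ i → f (suc i))

-- answer b is correct on input (P,x,q): for every i with p_i adjacent to q, b = x_i.
-- Under the promise this says exactly  b = x_i  for the unique neighbour p_i of q.
correct : ∀ {N n} → Graph N → Input N n → Bool → Bool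
correct G (P , x , q) b = allFin (λ i → not (G q (P i)) ∨ ⌊ b ≟B x i ⌋)

-- A finitely supported probability distribution on inputs: weighted list
Distribution : ℕ → ℕ → Set
Distribution N n = List (ℚ × Input N n)

totalWeight : ∀ {N n} → Distribution N n → ℚ
totalWeight [] = 0ℚ
totalWeight ((p , _) ∷ μ) = p + totalWeight μ

IsDistribution : ∀ {N n} → Distribution N n → Set
IsDistribution μ = All (λ pi → 0ℚ ≤ proj₁ pi) μ × (totalWeight μ ≡ 1ℚ)

successProb : ∀ {N n} → Graph N → Distribution N n → (Input N n → Bool) → ℚ
successProb G [] ans = 0ℚ
successProb G ((p , I) ∷ μ) ans =
  (if correct G I (ans I) then p else 0ℚ) + successProb G μ ans

record Adaptive (N n m w : ℕ) : Set where
  field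
    prep   : Dataset N n → (Fin n → Bool) → (Fin m → Cell w)
    probe₁ : Fin N → Fin m
    probe₂ : Fin N → Cell w → Fin m
    out    : Fin N → Cell w → Cell w → Bool

  answer : Input N n → Bool
  answer (P , x , q) =
    let D  = prep P x
        c₁ = D (probe₁ q)
        c₂ = D (probe₂ q c₁)
    in out q c₁ c₂

record NonAdaptive (N n m w : ℕ) : Set where
  field
    prep   : Dataset N n → (Fin n → Bool) → (Fin m → Cell w)
    probe₁ : Fin N → Fin m
    probe₂ : Fin N → Fin m
    out    : Fin N → Cell w → Cell w → Bool

  answer : Input N n → Bool
  answer (P , x , q) =
    let D = prep P x
    in out q (D (probe₁ q)) (D (probe₂ q))

½ : ℚ
½ = + 1 / 2

inv2^ : ℕ → ℚ
inv2^ w = _/_ (+ 1) (2 ^ w) {{m^n≢0 2 w}}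

module Submission where

-- Let A be adaptive.  For a guess c of the content of A's first probed cell and a
-- default bit b, the non-adaptive scheme  guess (b ∷ c)  probes A's first cell and
-- the cell A would probe second if the first cell held c; it answers as A when the
-- first cell really holds c, and answers b otherwise.  Average over all 2^(w+1)
-- pairs (b , c).  On a single input of weight p, exactly one guess c is right and
-- then the answer is A's; for the wrong guesses, the two defaults b earn p/2 on
-- average, because under the GNS promise exactly one constant answer is correct.
-- Hence the average weight earned is 2^-w · (A's weight) + ½ (1 - 2^-w) · p, and by
-- linearity the average success probability is 2^-w · s_A + ½ (1 - 2^-w), which is
-- at least ½ + η · 2^-w when s_A ≥ ½ + η.  Some guess (b , c) is at least as good as
-- the average.

open import Defs
open import Data.Nat using (ℕ)
open import Data.Rational using (ℚ; _+_; _*_; _≤_)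
open import Data.List.Relation.Unary.All using (All)
open import Data.Product using (Σ; proj₂)

open import Data.Nat as ℕ using (zero; suc)
open import Data.Integer using (+_)
open import Data.Rational using (0ℚ; 1ℚ; _/_; _-_; NonNegative)
open import Data.Rational.Properties
  using (toℚᵘ-injective; toℚᵘ-fromℚᵘ; toℚᵘ-homo-*; ≤-trans; ≤-total;
         +-mono-≤; +-comm; +-identityˡ; +-identityʳ; *-monoˡ-≤-nonNeg;
         normalize-nonNeg; ≤-reflexive; module ≤-Reasoning)
open import Data.Nat.Properties using (m^n≢0)
import Data.Rational.Unnormalised as ℚᵘ
import Data.Rational.Unnormalised.Properties as ℚᵘ
open import Data.Rational.Solver using (module +-*-Solver)
open +-*-Solver using (solve; _:=_; con; _:+_; _:*_; _:-_)
open import Relation.Binary.PropositionalEquality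
open import Data.Bool using (Bool; true; false; not; _∨_; if_then_else_)
open import Data.Bool.Properties using (¬-not) renaming (_≟_ to _≟B_)
open import Relation.Nullary using (Dec; does; yes; no)
open import Relation.Nullary.Decidable using (⌊_⌋; isYes≗does; dec-true; dec-false)
open import Data.Fin using (Fin) renaming (zero to fzero; suc to fsuc)
open import Data.Vec using ([]; _∷_)
open import Data.Vec.Properties using (≡-dec)
import Data.List.Relation.Unary.All as All
open import Data.List using ([]; _∷_)
open import Data.List.Relation.Unary.All using ([]; _∷_)
open import Data.Product using (_,_)
open import Data.Sum using (_⊎_; inj₁; inj₂)

inv-double : ∀ d .{{_ : ℕ.NonZero d}} .{{_ : ℕ.NonZero (2 ℕ.* d)}} →
             + 1 / (2 ℕ.* d) ≡ ½ * (+ 1 / d)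
inv-double (suc k) = toℚᵘ-injective (ℚᵘ.≃-trans
  (toℚᵘ-fromℚᵘ (ℚᵘ.mkℚᵘ (+ 1) (k ℕ.+ suc (k ℕ.+ 0))))
  (ℚᵘ.≃-sym (ℚᵘ.≃-trans (toℚᵘ-homo-* ½ (+ 1 / suc k))
                        (ℚᵘ.*-congˡ {ℚᵘ.mkℚᵘ (+ 1) 1} (toℚᵘ-fromℚᵘ (ℚᵘ.mkℚᵘ (+ 1) k))))))

inv2^-suc : ∀ w → inv2^ (suc w) ≡ ½ * inv2^ w
inv2^-suc w = inv-double (2 ℕ.^ w) {{m^n≢0 2 w}} {{m^n≢0 2 (suc w)}}

inv2^-nonNeg : ∀ w → NonNegative (inv2^ w)
inv2^-nonNeg w = normalize-nonNeg 1 (2 ℕ.^ w) {{m^n≢0 2 w}}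

half-double : ∀ p → ½ * (p + p) ≡ p
half-double = solve 1 (λ p → con ½ :* (p :+ p) := p) refl

mean≤larger : ∀ a b → a ≤ b → ½ * (a + b) ≤ b
mean≤larger a b a≤b =
  ≤-trans (*-monoˡ-≤-nonNeg ½ (+-mono-≤ a≤b (≤-reflexive refl))) (≤-reflexive (half-double b))

below-mean : ∀ {x} a b → x ≤ ½ * (a + b) → x ≤ a ⊎ x ≤ b
below-mean a b x≤mean with ≤-total a b
... | inj₁ a≤b = inj₂ (≤-trans x≤mean (mean≤larger a b a≤b))
... | inj₂ b≤a = inj₁ (≤-trans x≤mean (subst (λ s → ½ * s ≤ a) (+-comm b a) (mean≤larger b a b≤a)))

avg : ∀ w → (Cell w → ℚ) → ℚ
avg zero    h = h []
avg (suc w) h = ½ * (avg w (λ c → h (true ∷ c)) + avg w (λ c → h (false ∷ c)))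

avg-cong : ∀ w {f g : Cell w → ℚ} → (∀ c → f c ≡ g c) → avg w f ≡ avg w g
avg-cong zero    f≗g = f≗g []
avg-cong (suc w) f≗g =
  cong₂ (λ a b → ½ * (a + b)) (avg-cong w (λ c → f≗g (true ∷ c))) (avg-cong w (λ c → f≗g (false ∷ c)))

avg-const : ∀ w k → avg w (λ _ → k) ≡ k
avg-const zero    k = refl
avg-const (suc w) k =
  trans (cong₂ (λ a b → ½ * (a + b)) (avg-const w k) (avg-const w k)) (half-double k)

avg-+ : ∀ w (f g : Cell w → ℚ) → avg w (λ c → f c + g c) ≡ avg w f + avg w g
avg-+ zero    f g = refl
avg-+ (suc w) f g =
  trans (cong₂ (λ a b → ½ * (a + b)) (avg-+ w (λ c → f (true ∷ c)) (λ c → g (true ∷ c)))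
                                     (avg-+ w (λ c → f (false ∷ c)) (λ c → g (false ∷ c))))
        (solve 4 (λ a b c d → con ½ :* ((a :+ b) :+ (c :+ d)) := con ½ :* (a :+ c) :+ con ½ :* (b :+ d))
               refl (avg w (λ c → f (true ∷ c))) (avg w (λ c → g (true ∷ c)))
                     (avg w (λ c → f (false ∷ c))) (avg w (λ c → g (false ∷ c))))

avg-witness : ∀ w {x} h → x ≤ avg w h → Σ (Cell w) λ c → x ≤ h c
avg-witness zero    h x≤avg = [] , x≤avg
avg-witness (suc w) h x≤avg with below-mean _ _ x≤avg
... | inj₁ x≤t = let c , x≤h = avg-witness w (λ c → h (true ∷ c)) x≤t in true ∷ c , x≤h
... | inj₂ x≤f = let c , x≤h = avg-witness w (λ c → h (false ∷ c)) x≤f in false ∷ c , x≤h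

_≟ᶜ_ : ∀ {w} (c d : Cell w) → Dec (c ≡ d)
_≟ᶜ_ = ≡-dec _≟B_

-- One averaging step of a point-mass average: the cell that does not contain
-- the point contributes the constant p.
halve-point : ∀ w {X Y} a p → X ≡ inv2^ w * a + (1ℚ - inv2^ w) * p → Y ≡ p →
              ½ * (X + Y) ≡ inv2^ (suc w) * a + (1ℚ - inv2^ (suc w)) * p
halve-point w {X} {Y} a p X≡ Y≡p = begin
  ½ * (X + Y)                                    ≡⟨ cong₂ (λ X Y → ½ * (X + Y)) X≡ Y≡p ⟩
  ½ * ((i * a + (1ℚ - i) * p) + p)               ≡⟨ solve 3 (λ i a p →
      con ½ :* ((i :* a :+ (con 1ℚ :- i) :* p) :+ p)
      := con ½ :* i :* a :+ (con 1ℚ :- con ½ :* i) :* p) refl i a p ⟩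
  ½ * i * a + (1ℚ - ½ * i) * p                   ≡⟨ cong (λ j → j * a + (1ℚ - j) * p) (sym (inv2^-suc w)) ⟩
  inv2^ (suc w) * a + (1ℚ - inv2^ (suc w)) * p   ∎
  where
  open ≡-Reasoning
  i = inv2^ w

avg-point : ∀ w (c₀ : Cell w) a p →
            avg w (λ c → if does (c₀ ≟ᶜ c) then a else p) ≡ inv2^ w * a + (1ℚ - inv2^ w) * p
avg-point zero [] a p = solve 2 (λ a p → a := con 1ℚ :* a :+ (con 1ℚ :- con 1ℚ) :* p) refl a p
avg-point (suc w) (true ∷ c₀) a p = halve-point w a p (avg-point w c₀ a p) (avg-const w p)
avg-point (suc w) (false ∷ c₀) a p =
  trans (cong (½ *_) (+-comm (avg w (λ _ → p)) _)) (halve-point w a p (avg-point w c₀ a p) (avg-const w p))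

allFin-intro : ∀ {n} (f : Fin n → Bool) → (∀ i → f i ≡ true) → allFin f ≡ true
allFin-intro {zero}  f all-true = refl
allFin-intro {suc n} f all-true rewrite all-true fzero = allFin-intro (λ i → f (fsuc i)) (λ i → all-true (fsuc i))

allFin-elim : ∀ {n} (f : Fin n → Bool) → allFin f ≡ true → ∀ i → f i ≡ true
allFin-elim {suc n} f conj i with f fzero in f0
allFin-elim {suc n} f conj fzero    | true = f0
allFin-elim {suc n} f conj (fsuc i) | true = allFin-elim (λ j → f (fsuc j)) conj i

correct-unique : ∀ {N n} (G : Graph N) (P : Dataset N n) (x : Fin n → Bool) (q : Fin N) {i} →
                 UniqueNbr G P q i → ∀ b → correct G (P , x , q) b ≡ ⌊ b ≟B x i ⌋
correct-unique G P x q {i} (adj , unique) b with b ≟B x i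
... | yes b≡xᵢ = allFin-intro _ agrees
  where
  agrees : ∀ j → (not (G q (P j)) ∨ ⌊ b ≟B x j ⌋) ≡ true
  agrees j with G q (P j) in adjⱼ
  ... | false = refl
  ... | true  = trans (isYes≗does (b ≟B x j)) (dec-true (b ≟B x j) (trans b≡xᵢ (cong x (sym (unique j adjⱼ)))))
... | no b≢xᵢ = ¬-not λ conj →
  b≢xᵢ-true (subst (λ g → (not g ∨ ⌊ b ≟B x i ⌋) ≡ true) adj (allFin-elim _ conj i))
  where
  b≢xᵢ-true : ⌊ b ≟B x i ⌋ ≢ true
  b≢xᵢ-true eq with () ← trans (sym eq) (trans (isYes≗does (b ≟B x i)) (dec-false (b ≟B x i) b≢xᵢ))

credit : ∀ {N n} → Graph N → Input N n → ℚ → Bool → ℚ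
credit G I p b = if correct G I b then p else 0ℚ

credit-constants : ∀ {N n} (G : Graph N) {I : Input N n} → Promise G I →
                   ∀ p → credit G I p true + credit G I p false ≡ p
credit-constants G {P , x , q} (_ , i , u) p
  rewrite correct-unique G P x q u true | correct-unique G P x q u false with x i
... | true  = +-identityʳ p
... | false = +-identityˡ p

avg-successProb : ∀ {N n} w (G : Graph N) (ans : Cell w → Input N n → Bool)
                  (ansA : Input N n → Bool) (α β : ℚ) (μ : Distribution N n) →
                  All (λ (p , I) → avg w (λ c → credit G I p (ans c I))
                                   ≡ α * credit G I p (ansA I) + β * p) μ →
                  avg w (λ c → successProb G μ (ans c))
                  ≡ α * successProb G μ ansA + β * totalWeight μ
avg-successProb w G ans ansA α β [] [] =
  trans (avg-const w 0ℚ) (solve 2 (λ α β → con 0ℚ := α :* con 0ℚ :+ β :* con 0ℚ) refl α β)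
avg-successProb w G ans ansA α β ((p , I) ∷ μ) (entry ∷ rest) = begin
  avg w (λ c → credit G I p (ans c I) + successProb G μ (ans c))
    ≡⟨ avg-+ w _ _ ⟩
  avg w (λ c → credit G I p (ans c I)) + avg w (λ c → successProb G μ (ans c))
    ≡⟨ cong₂ _+_ entry (avg-successProb w G ans ansA α β μ rest) ⟩
  (α * t + β * p) + (α * s + β * T)
    ≡⟨ solve 6 (λ α β t p s T → (α :* t :+ β :* p) :+ (α :* s :+ β :* T)
                                := α :* (t :+ s) :+ β :* (p :+ T)) refl α β t p s T ⟩
  α * (t + s) + β * (p + T) ∎
  where
  open ≡-Reasoning
  t = credit G I p (ansA I)
  s = successProb G μ ansA
  T = totalWeight μ

module Guessing {N n m w : ℕ} (G : Graph N) (A : Adaptive N n m w) where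
  module A = Adaptive A

  guess : Cell (suc w) → NonAdaptive N n m w
  guess (b ∷ c) = record
    { prep   = A.prep
    ; probe₁ = A.probe₁
    ; probe₂ = λ q → A.probe₂ q c
    ; out    = λ q c₁ c₂ → if does (c₁ ≟ᶜ c) then A.out q c₁ c₂ else b
    }

  firstCell : Input N n → Cell w
  firstCell (P , x , q) = A.prep P x (A.probe₁ q)

  guess-answer : ∀ b c I → NonAdaptive.answer (guess (b ∷ c)) I
                           ≡ (if does (firstCell I ≟ᶜ c) then A.answer I else b)
  guess-answer b c (P , x , q) with firstCell (P , x , q) ≟ᶜ c
  ... | yes refl = refl
  ... | no _     = refl

  credit-both-defaults : ∀ {I} → Promise G I → ∀ p c →
    credit G I p (NonAdaptive.answer (guess (true ∷ c)) I)
      + credit G I p (NonAdaptive.answer (guess (false ∷ c)) I)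
    ≡ (if does (firstCell I ≟ᶜ c) then credit G I p (A.answer I) + credit G I p (A.answer I) else p)
  credit-both-defaults {I} promise p c
    rewrite guess-answer true c I | guess-answer false c I with firstCell I ≟ᶜ c
  ... | yes _ = refl
  ... | no _  = credit-constants G promise p

  avg-credit-guess : ∀ {I} → Promise G I → ∀ p →
    avg (suc w) (λ bc → credit G I p (NonAdaptive.answer (guess bc) I))
    ≡ inv2^ w * credit G I p (A.answer I) + ½ * (1ℚ - inv2^ w) * p
  avg-credit-guess {I} promise p = begin
    ½ * (avg w (earned true) + avg w (earned false))
      ≡⟨ cong (½ *_) (sym (avg-+ w (earned true) (earned false))) ⟩
    ½ * avg w (λ c → earned true c + earned false c)
      ≡⟨ cong (½ *_) (avg-cong w (credit-both-defaults promise p)) ⟩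
    ½ * avg w (λ c → if does (firstCell I ≟ᶜ c) then t + t else p)
      ≡⟨ cong (½ *_) (avg-point w (firstCell I) (t + t) p) ⟩
    ½ * (inv2^ w * (t + t) + (1ℚ - inv2^ w) * p)
      ≡⟨ solve 3 (λ i t p → con ½ :* (i :* (t :+ t) :+ (con 1ℚ :- i) :* p)
                             := i :* t :+ con ½ :* (con 1ℚ :- i) :* p) refl (inv2^ w) t p ⟩
    inv2^ w * t + ½ * (1ℚ - inv2^ w) * p ∎
    where
    open ≡-Reasoning
    t = credit G I p (A.answer I)
    earned : Bool → Cell w → ℚ
    earned b c = credit G I p (NonAdaptive.answer (guess (b ∷ c)) I)

lemma20 : (N n m w : ℕ) (G : Graph N) (μ : Distribution N n) →
          IsDistribution μ →
          All (λ pI → Promise G (proj₂ pI)) μ →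
          (η : ℚ) →
          (A : Adaptive N n m w) →
          ½ + η ≤ successProb G μ (Adaptive.answer A) →
          Σ (NonAdaptive N n m w) λ B →
            ½ + η * inv2^ w ≤ successProb G μ (NonAdaptive.answer B)
-- The guesses average 2^-w · s_A + ½ (1 - 2^-w) ≥ ½ + η · 2^-w; take a guess at
-- least as good as the average.
lemma20 N n m w G μ (_ , total≡1) promises η A A-good =
  let bc , bound = avg-witness (suc w) success ½+η2⁻ʷ≤average in guess bc , bound
  where
  open Guessing G A
  open ≤-Reasoning
  i = inv2^ w
  instance
    i-nonNeg : NonNegative i
    i-nonNeg = inv2^-nonNeg w
  sA = successProb G μ (Adaptive.answer A)
  success : Cell (suc w) → ℚ
  success bc = successProb G μ (NonAdaptive.answer (guess bc))
  average≡ : avg (suc w) success ≡ i * sA + ½ * (1ℚ - i) * 1ℚ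
  average≡ = trans (avg-successProb (suc w) G (λ bc → NonAdaptive.answer (guess bc)) (Adaptive.answer A)
                      i (½ * (1ℚ - i)) μ (All.map (λ promise → avg-credit-guess promise _) promises))
                   (cong (λ T → i * sA + ½ * (1ℚ - i) * T) total≡1)
  ½+η2⁻ʷ≤average : ½ + η * i ≤ avg (suc w) success
  ½+η2⁻ʷ≤average = begin
    ½ + η * i                        ≡⟨ solve 2 (λ i η → con ½ :+ η :* i
                                          := i :* (con ½ :+ η) :+ con ½ :* (con 1ℚ :- i) :* con 1ℚ) refl i η ⟩
    i * (½ + η) + ½ * (1ℚ - i) * 1ℚ  ≤⟨ +-mono-≤ (*-monoˡ-≤-nonNeg i A-good) (≤-reflexive refl) ⟩
    i * sA + ½ * (1ℚ - i) * 1ℚ       ≡⟨ sym average≡ ⟩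
    avg (suc w) success              ∎
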